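{- For every $\mathrm{IMLU}$-category $(\mathbf{M},\mathbf{N})$, the category $\mathbf{SCan}_{(\mathbf{M},\mathbf{N})}$ has finite limits.
   Context: Heyting category: finite limits, images, covers stable under pullback, each subobject poset a join-semilattice, each pullback map $f^*$ preserving finite joins with adjoints $\exists_f\dashv f^*\dashv\forall_f$. An $\mathrm{IMLU}$-category is a pair $(\mathbf{M},\mathbf{N})$ of Heyting categories with $\mathbf{N}$ a conservative (isomorphism-reflecting) Heyting subcategory of $\mathbf{M}$, together with: an object $U$ of $\mathbf{N}$ such that every object of $\mathbf{N}$ has a mono in $\mathbf{N}$ into $U$; an endofunctor $\mathbf{T}$ of $\mathbf{M}$ restricting to an endofunctor of $\mathbf{N}$ and a natural isomorphism $\iota:\mathrm{id}_\mathbf{M}\to\mathbf{T}$; an endofunctor $\mathbf{P}$ of $\mathbf{N}$ such that for each object $A$ of $\mathbf{N}$ there is $m_{\subseteq^\mathbf{T}_A}:\subseteq^\mathbf{T}_A\to\mathbf{T}A\times\mathbf{P}A$ in $\mathbf{N}$, monic in $\mathbf{M}$, such that for each $r:R\to\mathbf{T}A\times B$ in $\mathbf{N}$ monic in $\mathbf{M}$ there is $\chi:B\to\mathbf{P}A$ in $\mathbf{N}$ which is the unique morphism of $\mathbf{M}$ for which $r$ is a pullback in $\mathbf{M}$ of $m_{\subseteq^\mathbf{T}_A}$ along $\mathrm{id}\times\chi$; and a natural isomorphism $\mu:\mathbf{P}\mathbf{T}\to\mathbf{T}\mathbf{P}$ on $\mathbf{N}$. An object $X$ of $\mathbf{N}$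 is strongly Cantorian if $\iota_X:X\to\mathbf{T}X$ is an isomorphism in $\mathbf{N}$. $\mathbf{SCan}_{(\mathbf{M},\mathbf{N})}$ is the full subcategory of $\mathbf{N}$ on strongly Cantorian objects. -}

module Defs where

open import Level using (Level; _⊔_) renaming (suc to lsuc)
open import Data.Product using (Σ; Σ-syntax; _×_; _,_; proj₁; proj₂)
open import Relation.Binary.Structures using (IsEquivalence)

record Category (o ℓ e : Level) : Set (lsuc (o ⊔ ℓ ⊔ e)) where
  infix  4 _≈_
  infixr 9 _∘_
  field
    Obj       : Set o
    _⇒_       : Obj → Obj → Set ℓ
    _≈_       : ∀ {A B} → A ⇒ B → A ⇒ B → Set e
    id        : ∀ {A} → A ⇒ A
    _∘_       : ∀ {A B C} → B ⇒ C → A ⇒ B → A ⇒ C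
    assoc     : ∀ {A B C D} {f : A ⇒ B} {g : B ⇒ C} {h : C ⇒ D} →
                (h ∘ g) ∘ f ≈ h ∘ (g ∘ f)
    identityˡ : ∀ {A B} {f : A ⇒ B} → id ∘ f ≈ f
    identityʳ : ∀ {A B} {f : A ⇒ B} → f ∘ id ≈ f
    equiv     : ∀ {A B} → IsEquivalence (_≈_ {A} {B})
    ∘-resp-≈  : ∀ {A B C} {f h : B ⇒ C} {g i : A ⇒ B} →
                f ≈ h → g ≈ i → f ∘ g ≈ h ∘ i

_⇔_ : ∀ {a b} → Set a → Set b → Set (a ⊔ b)
X ⇔ Y = (X → Y) × (Y → X)

module Notions {o ℓ e} (C : Category o ℓ e) where
  open Category C

  Mono : ∀ {A B} → A ⇒ B → Set (o ⊔ ℓ ⊔ e)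
  Mono {A} m = ∀ {X} (g h : X ⇒ A) → m ∘ g ≈ m ∘ h → g ≈ h

  record Iso {A B} (f : A ⇒ B) : Set (ℓ ⊔ e) where
    field
      inv  : B ⇒ A
      isoˡ : inv ∘ f ≈ id
      isoʳ : f ∘ inv ≈ id

  -- f factors through g (for monos g: the subobject order)
  _≤_ : ∀ {S T A} → S ⇒ A → T ⇒ A → Set (ℓ ⊔ e)
  _≤_ {S} {T} m n = Σ (S ⇒ T) λ k → n ∘ k ≈ m

  record IsTerminal (T : Obj) : Set (o ⊔ ℓ ⊔ e) where
    field
      ! : ∀ {A} → A ⇒ T
      !-unique : ∀ {A} (f : A ⇒ T) → f ≈ !

  record IsProduct {A B P} (π₁ : P ⇒ A) (π₂ : P ⇒ B) : Set (o ⊔ ℓ ⊔ e) where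
    field
      ⟨_,_⟩   : ∀ {X} → X ⇒ A → X ⇒ B → X ⇒ P
      project₁ : ∀ {X} {f : X ⇒ A} {g : X ⇒ B} → π₁ ∘ ⟨ f , g ⟩ ≈ f
      project₂ : ∀ {X} {f : X ⇒ A} {g : X ⇒ B} → π₂ ∘ ⟨ f , g ⟩ ≈ g
      unique   : ∀ {X} {f : X ⇒ A} {g : X ⇒ B} (h : X ⇒ P) →
                 π₁ ∘ h ≈ f → π₂ ∘ h ≈ g → h ≈ ⟨ f , g ⟩

  record IsEqualizer {E A B} (eq : E ⇒ A) (f g : A ⇒ B) : Set (o ⊔ ℓ ⊔ e) where
    field
      equality  : f ∘ eq ≈ g ∘ eq
      equalize  : ∀ {X} (h : X ⇒ A) → f ∘ h ≈ g ∘ h → X ⇒ E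
      universal : ∀ {X} {h : X ⇒ A} (p : f ∘ h ≈ g ∘ h) → eq ∘ equalize h p ≈ h
      unique    : ∀ {X} {h : X ⇒ A} (p : f ∘ h ≈ g ∘ h) (u : X ⇒ E) →
                  eq ∘ u ≈ h → u ≈ equalize h p

  record IsPullback {P A B C} (p₁ : P ⇒ A) (p₂ : P ⇒ B) (f : A ⇒ C) (g : B ⇒ C)
         : Set (o ⊔ ℓ ⊔ e) where
    field
      commute   : f ∘ p₁ ≈ g ∘ p₂
      universal : ∀ {X} (h₁ : X ⇒ A) (h₂ : X ⇒ B) → f ∘ h₁ ≈ g ∘ h₂ → X ⇒ P
      p₁∘universal : ∀ {X} {h₁ : X ⇒ A} {h₂ : X ⇒ B} (eq : f ∘ h₁ ≈ g ∘ h₂) →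
                     p₁ ∘ universal h₁ h₂ eq ≈ h₁
      p₂∘universal : ∀ {X} {h₁ : X ⇒ A} {h₂ : X ⇒ B} (eq : f ∘ h₁ ≈ g ∘ h₂) →
                     p₂ ∘ universal h₁ h₂ eq ≈ h₂
      unique    : ∀ {X} {h₁ : X ⇒ A} {h₂ : X ⇒ B} (eq : f ∘ h₁ ≈ g ∘ h₂) (u : X ⇒ P) →
                  p₁ ∘ u ≈ h₁ → p₂ ∘ u ≈ h₂ → u ≈ universal h₁ h₂ eq

  record Terminal : Set (o ⊔ ℓ ⊔ e) where
    field
      ⊤ : Obj
      isTerminal : IsTerminal ⊤

  record Product (A B : Obj) : Set (o ⊔ ℓ ⊔ e) where
    field
      A×B : Obj
      π₁  : A×B ⇒ A
      π₂  : A×B ⇒ B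
      isProduct : IsProduct π₁ π₂

  record Equalizer {A B} (f g : A ⇒ B) : Set (o ⊔ ℓ ⊔ e) where
    field
      obj  : Obj
      arr  : obj ⇒ A
      isEqualizer : IsEqualizer arr f g

  record Pullback {A B C} (f : A ⇒ C) (g : B ⇒ C) : Set (o ⊔ ℓ ⊔ e) where
    field
      P  : Obj
      p₁ : P ⇒ A
      p₂ : P ⇒ B
      isPullback : IsPullback p₁ p₂ f g

  record HasFiniteLimits : Set (o ⊔ ℓ ⊔ e) where
    field
      terminal  : Terminal
      product   : ∀ A B → Product A B
      equalizer : ∀ {A B} (f g : A ⇒ B) → Equalizer f g
      pullback  : ∀ {A B C} (f : A ⇒ C) (g : B ⇒ C) → Pullback f g

  Cover : ∀ {A B} → A ⇒ B → Set (o ⊔ ℓ ⊔ e)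
  Cover {A} {B} c = ∀ {S} (m : S ⇒ B) (g : A ⇒ S) → Mono m → m ∘ g ≈ c → Iso m

  record Image {A B} (f : A ⇒ B) : Set (o ⊔ ℓ ⊔ e) where
    field
      I      : Obj
      m      : I ⇒ B
      mono   : Mono m
      factor : f ≤ m
      least  : ∀ {S} (n : S ⇒ B) → Mono n → f ≤ n → m ≤ n

  IsBottom : ∀ {Z A} → Z ⇒ A → Set (o ⊔ ℓ ⊔ e)
  IsBottom {Z} {A} z = Mono z × (∀ {S} (n : S ⇒ A) → Mono n → z ≤ n)

  IsJoin : ∀ {S T J A} → S ⇒ A → T ⇒ A → J ⇒ A → Set (o ⊔ ℓ ⊔ e)
  IsJoin {S} {T} {J} {A} m n j =
    Mono j × m ≤ j × n ≤ j ×
    (∀ {K} (k : K ⇒ A) → Mono k → m ≤ k → n ≤ k → j ≤ k)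

  -- for f : A ⇒ B and a subobject m of A, the subobject u of B is ∃_f m,
  -- i.e. u ≤ n  iff  m ≤ f^* n  for every subobject n of B
  -- (f^* n given by any pullback p of n along f)
  IsExists : ∀ {A B S E} → A ⇒ B → S ⇒ A → E ⇒ B → Set (o ⊔ ℓ ⊔ e)
  IsExists {A} {B} f m u =
    Mono u × (∀ {T P} (n : T ⇒ B) (p : P ⇒ A) (q : P ⇒ T) →
              Mono n → IsPullback p q f n → (u ≤ n) ⇔ (m ≤ p))

  -- u is ∀_f m:  f^* n ≤ m  iff  n ≤ u  for every subobject n of B
  IsForall : ∀ {A B S E} → A ⇒ B → S ⇒ A → E ⇒ B → Set (o ⊔ ℓ ⊔ e)
  IsForall {A} {B} f m u =
    Mono u × (∀ {T P} (n : T ⇒ B) (p : P ⇒ A) (q : P ⇒ T) →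
              Mono n → IsPullback p q f n → (n ≤ u) ⇔ (p ≤ m))

record Heyting {o ℓ e} (C : Category o ℓ e) : Set (o ⊔ ℓ ⊔ e) where
  open Category C
  open Notions C
  field
    finiteLimits : HasFiniteLimits
    images       : ∀ {A B} (f : A ⇒ B) → Image f
    coversStable : ∀ {A B D P} (c : A ⇒ B) (g : D ⇒ B) (p₁ : P ⇒ A) (p₂ : P ⇒ D) →
                   Cover c → IsPullback p₁ p₂ c g → Cover p₂
    bottom       : ∀ A → Σ Obj λ Z → Σ (Z ⇒ A) IsBottom
    join         : ∀ {S T A} (m : S ⇒ A) (n : T ⇒ A) → Mono m → Mono n →
                   Σ Obj λ J → Σ (J ⇒ A) λ j → IsJoin m n j
    pullbackBottom : ∀ {A B Z P} (f : A ⇒ B) (z : Z ⇒ B) (p : P ⇒ A) (q : P ⇒ Z) →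
                     IsBottom z → IsPullback p q f z → IsBottom p
    pullbackJoin : ∀ {A B S T J Pm Pn Pj} (f : A ⇒ B)
                     (m : S ⇒ B) (n : T ⇒ B) (j : J ⇒ B)
                     (pm : Pm ⇒ A) (qm : Pm ⇒ S) (pn : Pn ⇒ A) (qn : Pn ⇒ T)
                     (pj : Pj ⇒ A) (qj : Pj ⇒ J) →
                   Mono m → Mono n → IsJoin m n j →
                   IsPullback pm qm f m → IsPullback pn qn f n → IsPullback pj qj f j →
                   IsJoin pm pn pj
    -- adjoints  ∃_f ⊣ f^* ⊣ ∀_f
    existsᶠ      : ∀ {A B S} (f : A ⇒ B) (m : S ⇒ A) → Mono m →
                   Σ Obj λ E → Σ (E ⇒ B) λ u → IsExists f m u
    forallᶠ      : ∀ {A B S} (f : A ⇒ B) (m : S ⇒ A) → Mono m →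
                   Σ Obj λ E → Σ (E ⇒ B) λ u → IsForall f m u

record Functor {o ℓ e o′ ℓ′ e′} (C : Category o ℓ e) (D : Category o′ ℓ′ e′)
       : Set (o ⊔ ℓ ⊔ e ⊔ o′ ⊔ ℓ′ ⊔ e′) where
  private
    module C = Category C
    module D = Category D
  field
    F₀ : C.Obj → D.Obj
    F₁ : ∀ {A B} → A C.⇒ B → F₀ A D.⇒ F₀ B
    identity     : ∀ {A} → F₁ (C.id {A}) D.≈ D.id
    homomorphism : ∀ {A B C} {f : A C.⇒ B} {g : B C.⇒ C} →
                   F₁ (g C.∘ f) D.≈ F₁ g D.∘ F₁ f
    F-resp-≈     : ∀ {A B} {f g : A C.⇒ B} → f C.≈ g → F₁ f D.≈ F₁ g

idF : ∀ {o ℓ e} (C : Category o ℓ e) → Functor C C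
idF C = record
  { F₀ = λ A → A ; F₁ = λ f → f
  ; identity = IsEquivalence.refl equiv
  ; homomorphism = IsEquivalence.refl equiv
  ; F-resp-≈ = λ p → p }
  where open Category C

_∘F_ : ∀ {o ℓ e o′ ℓ′ e′ o″ ℓ″ e″}
         {C : Category o ℓ e} {D : Category o′ ℓ′ e′} {E : Category o″ ℓ″ e″} →
       Functor D E → Functor C D → Functor C E
_∘F_ {E = E} G F = record
  { F₀ = λ A → G.F₀ (F.F₀ A)
  ; F₁ = λ f → G.F₁ (F.F₁ f)
  ; identity = IsEquivalence.trans E.equiv (G.F-resp-≈ F.identity) G.identity
  ; homomorphism = IsEquivalence.trans E.equiv (G.F-resp-≈ F.homomorphism) G.homomorphism
  ; F-resp-≈ = λ p → G.F-resp-≈ (F.F-resp-≈ p) }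
  where
    module G = Functor G
    module F = Functor F
    module E = Category E

record NaturalIso {o ℓ e o′ ℓ′ e′} {C : Category o ℓ e} {D : Category o′ ℓ′ e′}
       (F G : Functor C D) : Set (o ⊔ ℓ ⊔ e ⊔ o′ ⊔ ℓ′ ⊔ e′) where
  private
    module C = Category C
    module D = Category D
    module F = Functor F
    module G = Functor G
  field
    η       : ∀ X → F.F₀ X D.⇒ G.F₀ X
    natural : ∀ {X Y} (f : X C.⇒ Y) → (η Y D.∘ F.F₁ f) D.≈ (G.F₁ f D.∘ η X)
    isIso   : ∀ X → Notions.Iso D (η X)

record SubCat {o ℓ e} (C : Category o ℓ e) (p q : Level)
       : Set (o ⊔ ℓ ⊔ e ⊔ lsuc (p ⊔ q)) where
  open Category C
  field
    ObjN   : Obj → Set p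
    HomN   : ∀ {A B} → A ⇒ B → Set q
    HomN-resp : ∀ {A B} {f g : A ⇒ B} → f ≈ g → HomN f → HomN g
    HomN-id   : ∀ {A} → ObjN A → HomN (id {A})
    HomN-∘    : ∀ {A B C} {f : A ⇒ B} {g : B ⇒ C} → HomN g → HomN f → HomN (g ∘ f)

-- morphisms of a subcategory (a record, so that domain and codomain are
-- recoverable by unification)
record SubHom {o ℓ e p q} {C : Category o ℓ e} (S : SubCat C p q)
       (A B : Σ (Category.Obj C) (SubCat.ObjN S)) : Set (ℓ ⊔ q) where
  constructor subhom
  field
    arr  : Category._⇒_ C (proj₁ A) (proj₁ B)
    inN  : SubCat.HomN S arr
open SubHom public

SubCategory : ∀ {o ℓ e p q} (C : Category o ℓ e) → SubCat C p q →
              Category (o ⊔ p) (ℓ ⊔ q) e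
SubCategory C S = record
  { Obj = Σ Obj ObjN
  ; _⇒_ = SubHom S
  ; _≈_ = λ f g → arr f ≈ arr g
  ; id = λ {A} → subhom id (HomN-id (proj₂ A))
  ; _∘_ = λ g f → subhom (arr g ∘ arr f) (HomN-∘ (inN g) (inN f))
  ; assoc = assoc
  ; identityˡ = identityˡ
  ; identityʳ = identityʳ
  ; equiv = record { refl = IsEquivalence.refl equiv
                   ; sym = IsEquivalence.sym equiv
                   ; trans = IsEquivalence.trans equiv }
  ; ∘-resp-≈ = ∘-resp-≈ }
  where
    open Category C
    open SubCat S

record FullHom {o ℓ e p} (C : Category o ℓ e) (Q : Category.Obj C → Set p)
       (A B : Σ (Category.Obj C) Q) : Set ℓ where
  constructor fullhom
  field
    fullarr : Category._⇒_ C (proj₁ A) (proj₁ B)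
open FullHom public

FullSubCategory : ∀ {o ℓ e p} (C : Category o ℓ e) → (Category.Obj C → Set p) →
                  Category (o ⊔ p) ℓ e
FullSubCategory C Q = record
  { Obj = Σ Obj Q
  ; _⇒_ = FullHom C Q
  ; _≈_ = λ f g → fullarr f ≈ fullarr g
  ; id = fullhom id
  ; _∘_ = λ g f → fullhom (fullarr g ∘ fullarr f)
  ; assoc = assoc
  ; identityˡ = identityˡ
  ; identityʳ = identityʳ
  ; equiv = record { refl = IsEquivalence.refl equiv
                   ; sym = IsEquivalence.sym equiv
                   ; trans = IsEquivalence.trans equiv }
  ; ∘-resp-≈ = ∘-resp-≈ }
  where open Category C

record IsConservativeHeytingSubcat {o ℓ e p q} (M : Category o ℓ e) (S : SubCat M p q)
       : Set (o ⊔ ℓ ⊔ e ⊔ p ⊔ q) where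
  private
    N = SubCategory M S
    module M = Category M
    module N = Category N
    module NM = Notions M
    module NN = Notions N
  field
    preservesTerminal  : ∀ (T : N.Obj) → NN.IsTerminal T → NM.IsTerminal (proj₁ T)
    preservesProducts  : ∀ {A B P : N.Obj} (π₁ : P N.⇒ A) (π₂ : P N.⇒ B) →
                         NN.IsProduct π₁ π₂ → NM.IsProduct (arr π₁) (arr π₂)
    preservesEqualizers : ∀ {E A B : N.Obj} (eq : E N.⇒ A) (f g : A N.⇒ B) →
                         NN.IsEqualizer eq f g → NM.IsEqualizer (arr eq) (arr f) (arr g)
    preservesPullbacks : ∀ {P A B C : N.Obj} (p₁ : P N.⇒ A) (p₂ : P N.⇒ B)
                           (f : A N.⇒ C) (g : B N.⇒ C) →
                         NN.IsPullback p₁ p₂ f g →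
                         NM.IsPullback (arr p₁) (arr p₂) (arr f) (arr g)
    preservesCovers    : ∀ {A B : N.Obj} (c : A N.⇒ B) → NN.Cover c → NM.Cover (arr c)
    preservesBottom    : ∀ {Z A : N.Obj} (z : Z N.⇒ A) → NN.IsBottom z → NM.IsBottom (arr z)
    preservesJoin      : ∀ {S T J A : N.Obj} (m : S N.⇒ A) (n : T N.⇒ A) (j : J N.⇒ A) →
                         NN.IsJoin m n j → NM.IsJoin (arr m) (arr n) (arr j)
    preservesForall    : ∀ {A B S E : N.Obj} (f : A N.⇒ B) (m : S N.⇒ A) (u : E N.⇒ B) →
                         NN.IsForall f m u → NM.IsForall (arr f) (arr m) (arr u)
    conservative       : ∀ {A B : N.Obj} (f : A N.⇒ B) → NM.Iso (arr f) → NN.Iso f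

restrict : ∀ {o ℓ e p q} {M : Category o ℓ e} (S : SubCat M p q) (T : Functor M M) →
           (∀ {A} → SubCat.ObjN S A → SubCat.ObjN S (Functor.F₀ T A)) →
           (∀ {A B} {f : Category._⇒_ M A B} → SubCat.HomN S f → SubCat.HomN S (Functor.F₁ T f)) →
           Functor (SubCategory M S) (SubCategory M S)
restrict S T To Th = record
  { F₀ = λ A → F₀ (proj₁ A) , To (proj₂ A)
  ; F₁ = λ f → subhom (F₁ (arr f)) (Th (inN f))
  ; identity = identity
  ; homomorphism = homomorphism
  ; F-resp-≈ = F-resp-≈ }
  where open Functor T

module _ {o ℓ e} (M : Category o ℓ e) (S : SubCat M o ℓ)
         (heytN : Heyting (SubCategory M S))
         (sub : IsConservativeHeytingSubcat M S)
         (TN : Functor (SubCategory M S) (SubCategory M S))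
         (P : Functor (SubCategory M S) (SubCategory M S)) where
  private
    N = SubCategory M S
    module M = Category M
    module N = Category N
    module NM = Notions M
    module NN = Notions N
    module TN = Functor TN
    module P = Functor P
    open Heyting heytN using (finiteLimits)
    open NN.HasFiniteLimits finiteLimits using (product)
    open IsConservativeHeytingSubcat sub using (preservesProducts)

  prodObj : N.Obj → N.Obj → N.Obj
  prodObj A B = NN.Product.A×B (product A B)

  -- id × χ : TA × B → TA × PA  in M, for χ : B → PA a morphism of M
  idx : ∀ (A B : N.Obj) → proj₁ B M.⇒ proj₁ (P.F₀ A) →
        proj₁ (prodObj (TN.F₀ A) B) M.⇒ proj₁ (prodObj (TN.F₀ A) (P.F₀ A))
  idx A B χ = NM.IsProduct.⟨_,_⟩ (preservesProducts _ _ (NN.Product.isProduct (product (TN.F₀ A) (P.F₀ A))))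
                (arr (NN.Product.π₁ (product (TN.F₀ A) B)))
                (χ M.∘ arr (NN.Product.π₂ (product (TN.F₀ A) B)))

  PowerObjectAxiom : Set (o ⊔ ℓ ⊔ e)
  PowerObjectAxiom =
    ∀ (A : N.Obj) →
    Σ N.Obj λ E →
    Σ (E N.⇒ prodObj (TN.F₀ A) (P.F₀ A)) λ m →
      NM.Mono (arr m) ×
      (∀ {R B : N.Obj} (r : R N.⇒ prodObj (TN.F₀ A) B) → NM.Mono (arr r) →
       Σ (B N.⇒ P.F₀ A) λ χ →
         (Σ (proj₁ R M.⇒ proj₁ E) λ k → NM.IsPullback (arr r) k (idx A B (arr χ)) (arr m)) ×
         (∀ (χ′ : proj₁ B M.⇒ proj₁ (P.F₀ A)) →
            (Σ (proj₁ R M.⇒ proj₁ E) λ k → NM.IsPullback (arr r) k (idx A B χ′) (arr m)) →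
            χ′ M.≈ arr χ))

record IMLU (o ℓ e : Level) : Set (lsuc (o ⊔ ℓ ⊔ e)) where
  field
    M     : Category o ℓ e
    heytM : Heyting M
    NS    : SubCat M o ℓ
    heytN : Heyting (SubCategory M NS)
    sub   : IsConservativeHeytingSubcat M NS
    U     : Category.Obj (SubCategory M NS)
    toU   : ∀ (A : Category.Obj (SubCategory M NS)) →
            Σ (Category._⇒_ (SubCategory M NS) A U) (Notions.Mono (SubCategory M NS))
    T     : Functor M M
    T-obj : ∀ {A} → SubCat.ObjN NS A → SubCat.ObjN NS (Functor.F₀ T A)
    T-hom : ∀ {A B} {f : Category._⇒_ M A B} → SubCat.HomN NS f → SubCat.HomN NS (Functor.F₁ T f)
    ι     : NaturalIso (idF M) T
    P     : Functor (SubCategory M NS) (SubCategory M NS)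
    power : PowerObjectAxiom M NS heytN sub (restrict NS T T-obj T-hom) P
    μ     : NaturalIso (P ∘F restrict NS T T-obj T-hom) (restrict NS T T-obj T-hom ∘F P)

  N : Category o ℓ e
  N = SubCategory M NS

  StronglyCantorian : Category.Obj N → Set (ℓ ⊔ e)
  StronglyCantorian X =
    Σ (SubCat.HomN NS (NaturalIso.η ι (proj₁ X))) λ h →
      Notions.Iso N {X} {Functor.F₀ (restrict NS T T-obj T-hom) X} (subhom (NaturalIso.η ι (proj₁ X)) h)

  SCan : Category (o ⊔ ℓ ⊔ e) ℓ e
  SCan = FullSubCategory N StronglyCantorian

module Submission where

-- Strongly Cantorian objects are closed under finite limits.
--
-- Let L be a limit in N of a diagram whose relevant vertices X are strongly
-- Cantorian.  Because N ⊆ M preserves finite limits, L is also a limit in M,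
-- so an M-map into L is determined by its composites with the legs p : L → X.
-- For each leg, the "twisted" leg  ι⁻¹_X ∘ T p : T L → X  lies in N (since
-- ι⁻¹_X does) and, by naturality of ι⁻¹, equals  p ∘ ι⁻¹_L  in M.  The twisted
-- legs again form a cone, so they induce an N-map  T L → L,  which agrees with
-- ι⁻¹_L after every leg and hence IS ι⁻¹_L.  Thus ι⁻¹_L lies in N, and
-- conservativity of N ⊆ M makes ι_L an isomorphism of N: L is strongly
-- Cantorian.  Finally, a limit in N whose vertex lies in a full subcategory is
-- a limit there as well.

open import Defs
open import Level using (_⊔_)
open import Data.Product using (_,_; proj₁; proj₂)
open import Relation.Binary.Structures using (IsEquivalence)

module CategoryFacts {o ℓ e} (C : Category o ℓ e) where
  open Category C
  open Notions C

  module ≈ {A B} = IsEquivalence (equiv {A} {B})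

  infix  1 begin_
  infixr 2 _≈⟨_⟩_
  infix  3 _∎

  begin_ : ∀ {A B} {f g : A ⇒ B} → f ≈ g → f ≈ g
  begin p = p

  _≈⟨_⟩_ : ∀ {A B} (f : A ⇒ B) {g h : A ⇒ B} → f ≈ g → g ≈ h → f ≈ h
  f ≈⟨ p ⟩ q = ≈.trans p q

  _∎ : ∀ {A B} (f : A ⇒ B) → f ≈ f
  f ∎ = ≈.refl

  refl⟩∘⟨_ : ∀ {A B D} {f : B ⇒ D} {g i : A ⇒ B} → g ≈ i → f ∘ g ≈ f ∘ i
  refl⟩∘⟨ p = ∘-resp-≈ ≈.refl p

  _⟩∘⟨refl : ∀ {A B D} {f h : B ⇒ D} {g : A ⇒ B} → f ≈ h → f ∘ g ≈ h ∘ g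
  p ⟩∘⟨refl = ∘-resp-≈ p ≈.refl

  left≈right-inverse : ∀ {A B} {f : A ⇒ B} {l r : B ⇒ A} →
                       l ∘ f ≈ id → f ∘ r ≈ id → l ≈ r
  left≈right-inverse {f = f} {l} {r} lf fr = begin
    l             ≈⟨ ≈.sym identityʳ ⟩
    l ∘ id        ≈⟨ refl⟩∘⟨ ≈.sym fr ⟩
    l ∘ (f ∘ r)   ≈⟨ ≈.sym assoc ⟩
    (l ∘ f) ∘ r   ≈⟨ lf ⟩∘⟨refl ⟩
    id ∘ r        ≈⟨ identityˡ ⟩
    r             ∎

  square-∘ʳ : ∀ {X P A B D} {f : A ⇒ D} {g : B ⇒ D} {p : P ⇒ A} {q : P ⇒ B}
              (x : X ⇒ P) → f ∘ p ≈ g ∘ q → f ∘ (p ∘ x) ≈ g ∘ (q ∘ x)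
  square-∘ʳ x sq = ≈.trans (≈.sym assoc) (≈.trans (sq ⟩∘⟨refl) assoc)

  terminal-ext : ∀ {T A} → IsTerminal T → (h k : A ⇒ T) → h ≈ k
  terminal-ext t h k = ≈.trans (!-unique h) (≈.sym (!-unique k))
    where open IsTerminal t

  product-ext : ∀ {X A B P} {π₁ : P ⇒ A} {π₂ : P ⇒ B} {h k : X ⇒ P} →
                IsProduct π₁ π₂ → π₁ ∘ h ≈ π₁ ∘ k → π₂ ∘ h ≈ π₂ ∘ k → h ≈ k
  product-ext {k = k} prod p q = ≈.trans (unique _ p q) (≈.sym (unique k ≈.refl ≈.refl))
    where open IsProduct prod

  equalizer-ext : ∀ {X E A B} {eq : E ⇒ A} {f g : A ⇒ B} {h k : X ⇒ E} →
                  IsEqualizer eq f g → eq ∘ h ≈ eq ∘ k → h ≈ k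
  equalizer-ext {eq = eq} {f} {g} {k = k} isEq p =
    ≈.trans (unique commutes _ p) (≈.sym (unique commutes k ≈.refl))
    where
      open IsEqualizer isEq
      commutes : f ∘ (eq ∘ k) ≈ g ∘ (eq ∘ k)
      commutes = square-∘ʳ k equality

  pullback-ext : ∀ {X P A B D} {p₁ : P ⇒ A} {p₂ : P ⇒ B} {f : A ⇒ D} {g : B ⇒ D}
                   {h k : X ⇒ P} →
                 IsPullback p₁ p₂ f g → p₁ ∘ h ≈ p₁ ∘ k → p₂ ∘ h ≈ p₂ ∘ k → h ≈ k
  pullback-ext {p₁ = p₁} {p₂} {f} {g} {k = k} isPb p q =
    ≈.trans (unique commutes _ p q) (≈.sym (unique commutes k ≈.refl ≈.refl))
    where
      open IsPullback isPb
      commutes : f ∘ (p₁ ∘ k) ≈ g ∘ (p₂ ∘ k)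
      commutes = square-∘ʳ k commute

inverse-natural : ∀ {o ℓ e o′ ℓ′ e′} {C : Category o ℓ e} {D : Category o′ ℓ′ e′}
                    {F G : Functor C D} (α : NaturalIso F G) →
                  let open Category D; open NaturalIso α
                      η⁻¹ = λ X → Notions.Iso.inv (isIso X) in
                  ∀ {X Y} (f : Category._⇒_ C X Y) →
                  η⁻¹ Y ∘ Functor.F₁ G f ≈ Functor.F₁ F f ∘ η⁻¹ X
inverse-natural {D = D} {F} {G} α {X} {Y} f = begin
  η⁻¹ Y ∘ G.F₁ f                      ≈⟨ ≈.sym identityʳ ⟩
  (η⁻¹ Y ∘ G.F₁ f) ∘ id               ≈⟨ refl⟩∘⟨ ≈.sym (isoʳ (isIso X)) ⟩
  (η⁻¹ Y ∘ G.F₁ f) ∘ (η X ∘ η⁻¹ X)    ≈⟨ assoc ⟩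
  η⁻¹ Y ∘ (G.F₁ f ∘ (η X ∘ η⁻¹ X))    ≈⟨ refl⟩∘⟨ ≈.sym assoc ⟩
  η⁻¹ Y ∘ ((G.F₁ f ∘ η X) ∘ η⁻¹ X)    ≈⟨ refl⟩∘⟨ (≈.sym (natural f) ⟩∘⟨refl) ⟩
  η⁻¹ Y ∘ ((η Y ∘ F.F₁ f) ∘ η⁻¹ X)    ≈⟨ refl⟩∘⟨ assoc ⟩
  η⁻¹ Y ∘ (η Y ∘ (F.F₁ f ∘ η⁻¹ X))    ≈⟨ ≈.sym assoc ⟩
  (η⁻¹ Y ∘ η Y) ∘ (F.F₁ f ∘ η⁻¹ X)    ≈⟨ isoˡ (isIso Y) ⟩∘⟨refl ⟩
  id ∘ (F.F₁ f ∘ η⁻¹ X)               ≈⟨ identityˡ ⟩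
  F.F₁ f ∘ η⁻¹ X                      ∎
  where
    open Category D
    open CategoryFacts D
    open NaturalIso α
    open Notions.Iso
    module F = Functor F
    module G = Functor G
    η⁻¹ : ∀ Z → Functor.F₀ G Z ⇒ Functor.F₀ F Z
    η⁻¹ Z = inv (isIso Z)

module FullSubcategoryLimits {o ℓ e p} (C : Category o ℓ e) (Q : Category.Obj C → Set p) where
  private
    module L = Notions C
    module F = Notions (FullSubCategory C Q)

  terminal : (T : L.Terminal) → Q (L.Terminal.⊤ T) → F.Terminal
  terminal T q = record
    { ⊤ = ⊤ , q
    ; isTerminal = record { ! = fullhom ! ; !-unique = λ h → !-unique (fullarr h) } }
    where
      open L.Terminal T
      open L.IsTerminal isTerminal

  product : ∀ {A B} (P : L.Product (proj₁ A) (proj₁ B)) → Q (L.Product.A×B P) →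
            F.Product A B
  product P q = record
    { A×B = A×B , q ; π₁ = fullhom π₁ ; π₂ = fullhom π₂
    ; isProduct = record
      { ⟨_,_⟩ = λ h k → fullhom ⟨ fullarr h , fullarr k ⟩
      ; project₁ = project₁
      ; project₂ = project₂
      ; unique = λ h → unique (fullarr h) } }
    where
      open L.Product P
      open L.IsProduct isProduct

  equalizer : ∀ {A B} {f g : FullHom C Q A B} (E : L.Equalizer (fullarr f) (fullarr g)) →
              Q (L.Equalizer.obj E) → F.Equalizer f g
  equalizer E q = record
    { obj = obj , q ; arr = fullhom eq
    ; isEqualizer = record
      { equality = equality
      ; equalize = λ h p → fullhom (equalize (fullarr h) p)
      ; universal = universal
      ; unique = λ p u → unique p (fullarr u) } }
    where
      open L.Equalizer E renaming (arr to eq)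
      open L.IsEqualizer isEqualizer

  pullback : ∀ {A B D} {f : FullHom C Q A D} {g : FullHom C Q B D}
             (P : L.Pullback (fullarr f) (fullarr g)) → Q (L.Pullback.P P) →
             F.Pullback f g
  pullback Pb q = record
    { P = P , q ; p₁ = fullhom p₁ ; p₂ = fullhom p₂
    ; isPullback = record
      { commute = commute
      ; universal = λ h₁ h₂ eq → fullhom (universal (fullarr h₁) (fullarr h₂) eq)
      ; p₁∘universal = p₁∘universal
      ; p₂∘universal = p₂∘universal
      ; unique = λ eq u → unique eq (fullarr u) } }
    where
      open L.Pullback Pb
      open L.IsPullback isPullback

module StronglyCantorianClosure {o ℓ e} (C : IMLU o ℓ e) where
  private
    module I  = IMLU C
    module M  = Category I.M
    module N  = Category I.N
    module NM = Notions I.M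
    module NN = Notions I.N
    module T  = Functor I.T
    module ι  = NaturalIso I.ι
    module S  = SubCat I.NS
    module CH = IsConservativeHeytingSubcat I.sub
    TN : Functor I.N I.N
    TN = restrict I.NS I.T I.T-obj I.T-hom
    module TN = Functor TN
    SC : N.Obj → Set (ℓ ⊔ e)
    SC = I.StronglyCantorian
  open M using (_∘_; _≈_)
  open CategoryFacts I.M

  -- The inverse of ι_X, a priori only a morphism of M.
  ι⁻¹ : ∀ X → T.F₀ X M.⇒ X
  ι⁻¹ X = NM.Iso.inv (ι.isIso X)

  -- For strongly Cantorian X, ι⁻¹_X is (the underlying map of) an N-morphism:
  -- it coincides with the inverse of ι_X in N.
  ι⁻¹ᴺ : ∀ {X} → SC X → TN.F₀ X N.⇒ X
  ι⁻¹ᴺ {X} (_ , iso) = subhom (ι⁻¹ (proj₁ X)) (S.HomN-resp inv≈ι⁻¹ (inN inv))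
    where
      open NN.Iso iso
      inv≈ι⁻¹ : arr inv ≈ ι⁻¹ (proj₁ X)
      inv≈ι⁻¹ = left≈right-inverse isoˡ (NM.Iso.isoʳ (ι.isIso (proj₁ X)))

  -- Criterion: if ι⁻¹_L underlies some N-morphism, then L is strongly
  -- Cantorian; by conservativity ι_L then also inverts inside N.
  sc-criterion : ∀ (L : N.Obj) (g : TN.F₀ L N.⇒ L) → arr g ≈ ι⁻¹ (proj₁ L) → SC L
  sc-criterion L g g≈ι⁻¹ = S.HomN-resp h≈ι (inN h) ,
    record { inv = g ; isoˡ = g∘ι≈id ; isoʳ = ι∘g≈id }
    where
      ιL : NM.Iso (ι.η (proj₁ L))
      ιL = ι.isIso (proj₁ L)
      g∘ι≈id : arr g ∘ ι.η (proj₁ L) ≈ M.id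
      g∘ι≈id = ≈.trans (g≈ι⁻¹ ⟩∘⟨refl) (NM.Iso.isoˡ ιL)
      ι∘g≈id : ι.η (proj₁ L) ∘ arr g ≈ M.id
      ι∘g≈id = ≈.trans (refl⟩∘⟨ g≈ι⁻¹) (NM.Iso.isoʳ ιL)
      gᴺ : NN.Iso g
      gᴺ = CH.conservative g (record { inv = ι.η (proj₁ L) ; isoˡ = ι∘g≈id ; isoʳ = g∘ι≈id })
      h : L N.⇒ TN.F₀ L
      h = NN.Iso.inv gᴺ
      h≈ι : arr h ≈ ι.η (proj₁ L)
      h≈ι = ≈.sym (left≈right-inverse ι∘g≈id (NN.Iso.isoʳ gᴺ))

  twist : ∀ {L X} → SC X → L N.⇒ X → TN.F₀ L N.⇒ X
  twist sx p = ι⁻¹ᴺ sx N.∘ TN.F₁ p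

  twist-arr : ∀ {L X} (sx : SC X) (p : L N.⇒ X) →
              arr (twist sx p) ≈ arr p ∘ ι⁻¹ (proj₁ L)
  twist-arr sx p = inverse-natural I.ι (arr p)

  twist-square : ∀ {L A B D} (sa : SC A) (sb : SC B)
                 (f : A N.⇒ D) (g : B N.⇒ D) (p : L N.⇒ A) (q : L N.⇒ B) →
                 arr f ∘ arr p ≈ arr g ∘ arr q →
                 arr f ∘ arr (twist sa p) ≈ arr g ∘ arr (twist sb q)
  twist-square sa sb f g p q sq = begin
    arr f ∘ arr (twist sa p)   ≈⟨ refl⟩∘⟨ twist-arr sa p ⟩
    arr f ∘ (arr p ∘ ι⁻¹ _)    ≈⟨ square-∘ʳ (ι⁻¹ _) sq ⟩
    arr g ∘ (arr q ∘ ι⁻¹ _)    ≈⟨ refl⟩∘⟨ ≈.sym (twist-arr sb q) ⟩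
    arr g ∘ arr (twist sb q)   ∎

  -- Each kind of finite limit of N: the mediating map of the twisted legs
  -- agrees with ι⁻¹ after every leg, hence is ι⁻¹ (legs are jointly monic in M).
  terminal-SC : (T : NN.Terminal) → SC (NN.Terminal.⊤ T)
  terminal-SC T = sc-criterion ⊤ ! (terminal-ext (CH.preservesTerminal ⊤ isTerminal) _ _)
    where
      open NN.Terminal T
      open NN.IsTerminal isTerminal

  product-SC : ∀ {A B} (P : NN.Product A B) → SC A → SC B → SC (NN.Product.A×B P)
  product-SC P sa sb = sc-criterion A×B mediator
    (product-ext (CH.preservesProducts π₁ π₂ isProduct)
      (≈.trans project₁ (twist-arr sa π₁))
      (≈.trans project₂ (twist-arr sb π₂)))
    where
      open NN.Product P
      open NN.IsProduct isProduct
      mediator : TN.F₀ A×B N.⇒ A×B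
      mediator = ⟨ twist sa π₁ , twist sb π₂ ⟩

  equalizer-SC : ∀ {A B} {f g : A N.⇒ B} (E : NN.Equalizer f g) → SC A →
                 SC (NN.Equalizer.obj E)
  equalizer-SC {f = f} {g} E sa = sc-criterion obj mediator
    (equalizer-ext (CH.preservesEqualizers arr′ f g isEqualizer)
      (≈.trans (universal commutes) (twist-arr sa arr′)))
    where
      open NN.Equalizer E renaming (arr to arr′)
      open NN.IsEqualizer isEqualizer
      commutes : arr f ∘ arr (twist sa arr′) ≈ arr g ∘ arr (twist sa arr′)
      commutes = twist-square sa sa f g arr′ arr′ equality
      mediator : TN.F₀ obj N.⇒ obj
      mediator = equalize (twist sa arr′) commutes

  pullback-SC : ∀ {A B D} {f : A N.⇒ D} {g : B N.⇒ D} (Pb : NN.Pullback f g) →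
                SC A → SC B → SC (NN.Pullback.P Pb)
  pullback-SC {f = f} {g} Pb sa sb = sc-criterion P mediator
    (pullback-ext (CH.preservesPullbacks p₁ p₂ f g isPullback)
      (≈.trans (p₁∘universal commutes) (twist-arr sa p₁))
      (≈.trans (p₂∘universal commutes) (twist-arr sb p₂)))
    where
      open NN.Pullback Pb
      open NN.IsPullback isPullback
      commutes : arr f ∘ arr (twist sa p₁) ≈ arr g ∘ arr (twist sb p₂)
      commutes = twist-square sa sb f g p₁ p₂ commute
      mediator : TN.F₀ P N.⇒ P
      mediator = universal (twist sa p₁) (twist sb p₂) commutes

mainTheorem10 : ∀ {o ℓ e} (C : IMLU o ℓ e) → Notions.HasFiniteLimits (IMLU.SCan C)
mainTheorem10 C = record
  { terminal  = Lift.terminal terminal (terminal-SC terminal)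
  ; product   = λ A B →
      Lift.product (product _ _) (product-SC (product _ _) (proj₂ A) (proj₂ B))
  ; equalizer = λ {A} f g →
      Lift.equalizer (equalizer _ _) (equalizer-SC (equalizer _ _) (proj₂ A))
  ; pullback  = λ {A} {B} f g →
      Lift.pullback (pullback _ _) (pullback-SC (pullback _ _) (proj₂ A) (proj₂ B)) }
  where
    open StronglyCantorianClosure C
    open Notions.HasFiniteLimits (Heyting.finiteLimits (IMLU.heytN C))
    module Lift = FullSubcategoryLimits (IMLU.N C) (IMLU.StronglyCantorian C)
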